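{- Let $s$ and $t$ be coprime integers with $t\geq1$, and such that $s\geq 0$ if $t=1$. Then for every prime $p$ and every integer $k\geq1$, \[v_p\big((s+t)(s+2t)\cdots(s+kt)\big)\leq v_p\big((|s|+kt)!\big).\]
   Context: $v_p(n)$ denotes the $p$-adic valuation of the integer $n$ (with $v_p(0)=+\infty$). -}

module Defs where

open import Data.Nat as ℕ using (ℕ; zero; suc; _^_)
open import Data.Nat.Divisibility using (_∣_)
open import Data.Integer as ℤ using (ℤ; +_; ∣_∣)

shiftedProd : ℤ → ℤ → ℕ → ℤ
shiftedProd s t zero    = + 1
shiftedProd s t (suc k) = shiftedProd s t k ℤ.* (s ℤ.+ (+ suc k) ℤ.* t)

-- p-adic valuation comparison  v_p(a) ≤ v_p(b)  (values in ℕ ∪ {+∞}, v_p(0) = +∞):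
-- it holds iff every power of p dividing a also divides b.
_≤ᵥ[_]_ : ℕ → ℕ → ℕ → Set
a ≤ᵥ[ p ] b = ∀ (e : ℕ) → p ^ e ∣ a → p ^ e ∣ b

{-# OPTIONS --safe #-}
-- The product in fact divides (|s| + k t)!.
-- Since x! · y ∣ y! whenever x < y, multiplying in strictly increasing factors one at a time keeps
-- the partial product inside a factorial. For s ≥ 0 the factors s + m t increase, so
-- ∏ · s! ∣ (s + k t)!. For s = −(a + 1) < 0 the factors |m t − a − 1| first decrease through
-- [1, a] and then increase from 1; none of them vanishes, since t ∣ s would force t = 1 by
-- coprimality and then s ≥ 0. Hence ∏ ∣ a! · (k t − a − 1)!, which divides (a + (k t − a − 1))!.
module Submission where

open import Defs
open import Data.Nat using (ℕ; _≥_; _!)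
open import Data.Nat.Primality using (Prime)
open import Data.Integer using (ℤ; +_; ∣_∣; _+_; _*_; _≤_)
open import Data.Integer.GCD using (gcd)
open import Relation.Binary.PropositionalEquality using (_≡_)

open import Data.Nat as ℕ using (suc; s≤s; z≤n; _<_; _∸_; NonZero; >-nonZero⁻¹)
open import Data.Nat.Properties
open import Data.Nat.Divisibility
open import Data.Nat.Coprimality using (gcd≡1⇒coprime)
open import Data.Nat.Combinatorics using (k![n∸k]!∣n!)
open import Data.Integer using (-[1+_]; _⊖_; +≤+)
open import Data.Integer.Properties using (abs-*; pos-*; ∣⊖∣-≤; ⊖-≥)
open import Data.Product using (_,_)
open import Relation.Nullary using (¬_; yes; no; contradiction)
open import Relation.Binary using (Tri; tri<; tri≈; tri>)
open import Relation.Binary.PropositionalEquality using (sym; trans; cong; subst)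
open import Algebra.Properties.CommutativeSemigroup *-commutativeSemigroup using (xy∙z≈xz∙y)

m<n⇒m!*n∣n! : ∀ {m n} → m < n → m ! ℕ.* n ∣ n !
m<n⇒m!*n∣n! {m} {suc n} (s≤s m≤n) =
  subst (m ! ℕ.* suc n ∣_) (*-comm (n !) (suc n)) (*-monoˡ-∣ (suc n) (m≤n⇒m!∣n! m≤n))

m!*n!∣[m+n]! : ∀ m n → m ! ℕ.* n ! ∣ (m ℕ.+ n) !
m!*n!∣[m+n]! m n =
  subst (λ o → m ! ℕ.* o ! ∣ (m ℕ.+ n) !) (m+n∸m≡n m n) (k![n∸k]!∣n! (m≤m+n m n))

m<n∧o<n⇒m∸o<n∸o : ∀ {m n o} → m < n → o < n → m ∸ o < n ∸ o
m<n∧o<n⇒m∸o<n∸o {m} {n} {o} m<n o<n with o ℕ.≤? m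
... | yes o≤m = ∸-monoˡ-< m<n o≤m
... | no  o≰m = subst (_< n ∸ o) (sym (m≤n⇒m∸n≡0 (<⇒≤ (≰⇒> o≰m)))) (m<n⇒0<n∸m o<n)

∣shiftedProd-+-suc∣ : ∀ c d k →
  ∣ shiftedProd (+ c) (+ d) (suc k) ∣ ≡ ∣ shiftedProd (+ c) (+ d) k ∣ ℕ.* (c ℕ.+ suc k ℕ.* d)
∣shiftedProd-+-suc∣ c d k = trans (abs-* (shiftedProd (+ c) (+ d) k) _)
  (cong (λ x → ∣ shiftedProd (+ c) (+ d) k ∣ ℕ.* ∣ + c + x ∣) (sym (pos-* (suc k) d)))

∣shiftedProd-[1+a]-suc∣ : ∀ a d k →
  ∣ shiftedProd -[1+ a ] (+ d) (suc k) ∣ ≡ ∣ shiftedProd -[1+ a ] (+ d) k ∣ ℕ.* ∣ suc k ℕ.* d ⊖ suc a ∣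
∣shiftedProd-[1+a]-suc∣ a d k = trans (abs-* (shiftedProd -[1+ a ] (+ d) k) _)
  (cong (λ x → ∣ shiftedProd -[1+ a ] (+ d) k ∣ ℕ.* ∣ -[1+ a ] + x ∣) (sym (pos-* (suc k) d)))

∣shiftedProd-+∣*c!∣[c+k*d]! : ∀ c d .{{_ : NonZero d}} k →
  ∣ shiftedProd (+ c) (+ d) k ∣ ℕ.* c ! ∣ (c ℕ.+ k ℕ.* d) !
∣shiftedProd-+∣*c!∣[c+k*d]! c d ℕ.zero =
  subst (_∣ (c ℕ.+ 0) !) (sym (*-identityˡ (c !))) (m≤n⇒m!∣n! (m≤m+n c 0))
∣shiftedProd-+∣*c!∣[c+k*d]! c d (suc k) = begin
  ∣ shiftedProd (+ c) (+ d) (suc k) ∣ ℕ.* c !  ≡⟨ cong (ℕ._* c !) (∣shiftedProd-+-suc∣ c d k) ⟩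
  P ℕ.* x ℕ.* c !                              ≡⟨ xy∙z≈xz∙y P x (c !) ⟩
  P ℕ.* c ! ℕ.* x                              ∣⟨ *-monoˡ-∣ x (∣shiftedProd-+∣*c!∣[c+k*d]! c d k) ⟩
  (c ℕ.+ k ℕ.* d) ! ℕ.* x                      ∣⟨ m<n⇒m!*n∣n! (+-monoʳ-< c (m<n+m (k ℕ.* d) (>-nonZero⁻¹ d))) ⟩
  x !                                          ∎
  where
  open ∣-Reasoning
  P = ∣ shiftedProd (+ c) (+ d) k ∣
  x = c ℕ.+ suc k ℕ.* d

-- Truncated subtraction lets one invariant cover both phases: while m d ≤ a the factors
-- a + 1 − m d fill the gap between (a − m d)! and a!, once m d > a + 1 the factors m d − a − 1
-- build up (m d − a − 1)!.
∣shiftedProd-[1+a]∣*[a∸k*d]!∣a!*[k*d∸1+a]! : ∀ a d .{{_ : NonZero d}} → ¬ d ∣ suc a → ∀ k →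
  ∣ shiftedProd -[1+ a ] (+ d) k ∣ ℕ.* (a ∸ k ℕ.* d) ! ∣ a ! ℕ.* (k ℕ.* d ∸ suc a) !
∣shiftedProd-[1+a]∣*[a∸k*d]!∣a!*[k*d∸1+a]! a d d∤1+a ℕ.zero = ∣-reflexive (*-comm 1 (a !))
∣shiftedProd-[1+a]∣*[a∸k*d]!∣a!*[k*d∸1+a]! a d d∤1+a (suc k) = step (<-cmp M (suc a))
  where
  open ∣-Reasoning
  M = suc k ℕ.* d
  P = ∣ shiftedProd -[1+ a ] (+ d) k ∣
  IH = ∣shiftedProd-[1+a]∣*[a∸k*d]!∣a!*[k*d∸1+a]! a d d∤1+a k
  k*d<M = m<n+m (k ℕ.* d) (>-nonZero⁻¹ d)

  step : Tri (M < suc a) (M ≡ suc a) (suc a < M) →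
    ∣ shiftedProd -[1+ a ] (+ d) (suc k) ∣ ℕ.* (a ∸ M) ! ∣ a ! ℕ.* (M ∸ suc a) !
  step (tri< M<1+a _ _) = begin
    ∣ shiftedProd -[1+ a ] (+ d) (suc k) ∣ ℕ.* (a ∸ M) !
      ≡⟨ cong (ℕ._* (a ∸ M) !) (trans (∣shiftedProd-[1+a]-suc∣ a d k) (cong (P ℕ.*_) factor≡)) ⟩
    P ℕ.* suc (a ∸ M) ℕ.* (a ∸ M) !  ≡⟨ *-assoc P (suc (a ∸ M)) ((a ∸ M) !) ⟩
    P ℕ.* suc (a ∸ M) !              ∣⟨ *-monoʳ-∣ P (m≤n⇒m!∣n! (∸-monoʳ-< k*d<M M≤a)) ⟩
    P ℕ.* (a ∸ k ℕ.* d) !            ∣⟨ IH ⟩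
    a ! ℕ.* (k ℕ.* d ∸ suc a) !      ∣⟨ *-monoʳ-∣ (a !) (m≤n⇒m!∣n! (∸-monoˡ-≤ (suc a) (<⇒≤ k*d<M))) ⟩
    a ! ℕ.* (M ∸ suc a) !            ∎
    where
    M≤a = ≤-pred M<1+a
    factor≡ : ∣ M ⊖ suc a ∣ ≡ suc (a ∸ M)
    factor≡ = trans (∣⊖∣-≤ (<⇒≤ M<1+a)) (+-∸-assoc 1 M≤a)
  step (tri≈ _ M≡1+a _) = contradiction (divides (suc k) (sym M≡1+a)) d∤1+a
  step (tri> _ _ 1+a<M) = begin
    ∣ shiftedProd -[1+ a ] (+ d) (suc k) ∣ ℕ.* (a ∸ M) !
      ≡⟨ cong (ℕ._* (a ∸ M) !) (trans (∣shiftedProd-[1+a]-suc∣ a d k) (cong (P ℕ.*_) factor≡)) ⟩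
    P ℕ.* x ℕ.* (a ∸ M) !                ≡⟨ xy∙z≈xz∙y P x ((a ∸ M) !) ⟩
    P ℕ.* (a ∸ M) ! ℕ.* x                ∣⟨ *-monoˡ-∣ x (*-monoʳ-∣ P (m≤n⇒m!∣n! (∸-monoʳ-≤ a (<⇒≤ k*d<M)))) ⟩
    P ℕ.* (a ∸ k ℕ.* d) ! ℕ.* x          ∣⟨ *-monoˡ-∣ x IH ⟩
    a ! ℕ.* (k ℕ.* d ∸ suc a) ! ℕ.* x    ≡⟨ *-assoc (a !) _ x ⟩
    a ! ℕ.* ((k ℕ.* d ∸ suc a) ! ℕ.* x)  ∣⟨ *-monoʳ-∣ (a !) (m<n⇒m!*n∣n! (m<n∧o<n⇒m∸o<n∸o k*d<M 1+a<M)) ⟩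
    a ! ℕ.* x !                          ∎
    where
    x = M ∸ suc a
    factor≡ : ∣ M ⊖ suc a ∣ ≡ x
    factor≡ = cong ∣_∣ (⊖-≥ (<⇒≤ 1+a<M))

∣shiftedProd∣∣[∣s∣+k*∣t∣]! : ∀ s t → gcd s t ≡ + 1 → + 1 ≤ t → (t ≡ + 1 → + 0 ≤ s) → ∀ k →
  ∣ shiftedProd s t k ∣ ∣ (∣ s ∣ ℕ.+ k ℕ.* ∣ t ∣) !
∣shiftedProd∣∣[∣s∣+k*∣t∣]! (+ c) (+ suc d) _ (+≤+ (s≤s z≤n)) _ k =
  ∣-trans (m∣m*n (c !)) (∣shiftedProd-+∣*c!∣[c+k*d]! c (suc d) k)
∣shiftedProd∣∣[∣s∣+k*∣t∣]! -[1+ a ] (+ suc d) gcd≡1 (+≤+ (s≤s z≤n)) t≡1⇒0≤s k = begin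
  ∣ shiftedProd -[1+ a ] (+ suc d) k ∣               ∣⟨ m∣m*n ((a ∸ k*t) !) ⟩
  ∣ shiftedProd -[1+ a ] (+ suc d) k ∣ ℕ.* (a ∸ k*t) !  ∣⟨ ∣shiftedProd-[1+a]∣*[a∸k*d]!∣a!*[k*d∸1+a]! a (suc d) t∤1+a k ⟩
  a ! ℕ.* (k*t ∸ suc a) !                            ∣⟨ m!*n!∣[m+n]! a (k*t ∸ suc a) ⟩
  (a ℕ.+ (k*t ∸ suc a)) !                            ∣⟨ m≤n⇒m!∣n! (+-mono-≤ (n≤1+n a) (m∸n≤m k*t (suc a))) ⟩
  (suc a ℕ.+ k*t) !                                  ∎
  where
  open ∣-Reasoning
  k*t = k ℕ.* suc d
  t∤1+a : ¬ suc d ∣ suc a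
  t∤1+a t∣1+a = contradiction (t≡1⇒0≤s (cong +_ (gcd≡1⇒coprime (cong ∣_∣ gcd≡1) (t∣1+a , ∣-refl)))) λ ()

mainTheorem11 : (s t : ℤ) → gcd s t ≡ + 1 → + 1 ≤ t → (t ≡ + 1 → + 0 ≤ s) →
    (p : ℕ) → Prime p → (k : ℕ) → k ≥ 1 →
    ∣ shiftedProd s t k ∣ ≤ᵥ[ p ] ((∣ s ∣ Data.Nat.+ k Data.Nat.* ∣ t ∣) !)
mainTheorem11 s t gcd≡1 1≤t t≡1⇒0≤s _ _ k _ _ pᵉ∣P =
  ∣-trans pᵉ∣P (∣shiftedProd∣∣[∣s∣+k*∣t∣]! s t gcd≡1 1≤t t≡1⇒0≤s k)
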